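{- Let $A(x)=\sum_{n\ge0}a_nx^n$ and let $B(x)=\sum_{k\ge0}b_kx^k$ be a reversion of $A$, i.e. $B(A(x))=\sum_{k\ge0}b_kA(x)^k=x$, with coefficients computed termwise, $[x^n]B(A(x))=\sum_{k\ge0}b_k[x^n]A(x)^k$. For $k\ge1$ and $n\ge0$ let $a^{(k)}_n=[x^n]A(x)^k$, and define $\tilde a^{(k)}_n$ by $\tilde a^{(1)}_n=0$ and, for $k>1$, $\tilde a^{(k)}_n=\sum_{j=1}^{n-1}a_{n-j}\,a^{(k-1)}_j+a_0\,\tilde a^{(k-1)}_n$. Then for every $n>1$, $$a_n=-a_1\sum_{k>0}b_k\,\tilde a^{(k)}_n.$$
   Context: $[x^n]P(x)$ denotes the coefficient of $x^n$ in the power series $P(x)$. The composition $B(A(x))$ and the sums $\sum_{k>0}k b_k a_0^{k-1}$, $\sum_{k>0}b_k\tilde a^{(k)}_n$ are assumed to be well defined (e.g. when $B$ is a polynomial, or when $a_0=0$). An empty sum is $0$. -}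

module Defs where


open import Algebra.Bundles using (CommutativeRing)
open import Data.Nat as ℕ using (ℕ; zero; suc; _∸_)
open import Data.Product using (∃; _×_)
import Relation.Nullary

-- Formal power series over a commutative ring R, represented by their
-- coefficient sequences ℕ → Carrier (the n-th entry is [x^n]).
module Series {c ℓ} (R : CommutativeRing c ℓ) where
  open CommutativeRing R

  Σ< : ℕ → (ℕ → Carrier) → Carrier
  Σ< zero    f = 0#
  Σ< (suc n) f = Σ< n f + f n

  _⊛_ : (ℕ → Carrier) → (ℕ → Carrier) → (ℕ → Carrier)
  (f ⊛ g) n = Σ< (suc n) (λ j → f j * g (n ∸ j))

  one : ℕ → Carrier
  one zero    = 1#
  one (suc n) = 0#

  pow : (ℕ → Carrier) → ℕ → ℕ → Carrier
  pow a zero    = one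
  pow a (suc k) = a ⊛ pow a k

  δ : ℕ → ℕ → Carrier
  δ m n with m ℕ.≟ n
  ... | Relation.Nullary.yes _ = 1#
  ... | Relation.Nullary.no  _ = 0#

  -- ã^{(k)}_n for k ≥ 1:  ã^{(1)}_n = 0,
  -- ã^{(k)}_n = Σ_{j=1}^{n-1} a_{n-j} a^{(k-1)}_j + a_0 ã^{(k-1)}_n  (k > 1).
  -- (The value at k = 0 is never used.)
  tilde : (ℕ → Carrier) → ℕ → ℕ → Carrier
  tilde a zero          n = 0#
  tilde a (suc zero)    n = 0#
  tilde a (suc (suc k)) n =
    Σ< (n ∸ 1) (λ i → a (n ∸ suc i) * pow a (suc k) (suc i)) + a 0 * tilde a (suc k) n

  -- A sum Σ_{k≥0} f k is well defined (only finitely many nonzero terms,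
  -- all beyond N vanishing) and equals s.
  HasSum : (ℕ → Carrier) → Carrier → Set ℓ
  HasSum f s = ∃ λ N → (∀ k → N ℕ.< k → f k ≈ 0#) × (s ≈ Σ< (suc N) f)

  _·_ : ℕ → Carrier → Carrier
  zero  · x = 0#
  suc n · x = x + n · x

  _^_ : Carrier → ℕ → Carrier
  x ^ zero  = 1#
  x ^ suc n = x * x ^ n

-- Expanding A(x)^k by its first factor shows that for n ≥ 1 the coefficient
-- a^{(k)}_n is affine in a_n:  a^{(k)}_n = k a_0^{k-1} a_n + ã^{(k)}_n,
-- where ã^{(k)}_n only involves a_1, …, a_{n-1}.  Summing against b_k, the
-- reversion identity B(A(x)) = x gives  S a_n + T_n = [x^n] x  with
-- S = Σ_{k>0} k b_k a_0^{k-1} and T_n = Σ_{k>0} b_k ã^{(k)}_n.  As ã^{(k)}_1 = 0,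
-- the case n = 1 reads S a_1 = 1, so S is invertible with inverse a_1, and the
-- case n > 1, S a_n + T_n = 0, can be solved for a_n.
module Submission where

open import Defs
open import Algebra.Bundles using (CommutativeRing)
open import Data.Nat as ℕ using (ℕ; zero; suc; _∸_; _<_; _≤_; _⊔_; s≤s)
open import Data.Nat.Properties as ℕ using ()
open import Data.Product using (∃; _,_)
import Relation.Binary.PropositionalEquality as ≡
import Algebra.Properties.Group as GroupProperties
import Algebra.Properties.Ring as RingProperties
import Algebra.Solver.Ring.NaturalCoefficients.Default as NaturalSolver
import Relation.Binary.Reasoning.Setoid as SetoidReasoning

module _ {c ℓ} (R : CommutativeRing c ℓ) where
  open CommutativeRing R
  open Series R
  open SetoidReasoning setoid
  open GroupProperties +-group using (inverseˡ-unique)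
  open RingProperties ring using (-‿distribʳ-*)
  open NaturalSolver commutativeSemiring using (solve; _:=_; _:+_; _:*_)

  Σ<-cong : ∀ n {f g : ℕ → Carrier} → (∀ i → i < n → f i ≈ g i) → Σ< n f ≈ Σ< n g
  Σ<-cong zero    f≈g = refl
  Σ<-cong (suc n) f≈g =
    +-cong (Σ<-cong n (λ i i<n → f≈g i (ℕ.m<n⇒m<1+n i<n))) (f≈g n (ℕ.n<1+n n))

  Σ<-zero : ∀ n {f : ℕ → Carrier} → (∀ i → f i ≈ 0#) → Σ< n f ≈ 0#
  Σ<-zero zero    f≈0 = refl
  Σ<-zero (suc n) f≈0 = trans (+-cong (Σ<-zero n f≈0) (f≈0 n)) (+-identityʳ 0#)

  Σ<-+ : ∀ n (f g : ℕ → Carrier) → Σ< n (λ i → f i + g i) ≈ Σ< n f + Σ< n g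
  Σ<-+ zero    f g = sym (+-identityʳ 0#)
  Σ<-+ (suc n) f g = trans (+-congʳ (Σ<-+ n f g)) (solve 4 (λ x y z w →
    (x :+ y) :+ (z :+ w) := (x :+ z) :+ (y :+ w)) refl _ _ _ _)

  Σ<-*ʳ : ∀ n (f : ℕ → Carrier) x → Σ< n (λ i → f i * x) ≈ Σ< n f * x
  Σ<-*ʳ zero    f x = sym (zeroˡ x)
  Σ<-*ʳ (suc n) f x = trans (+-congʳ (Σ<-*ʳ n f x)) (sym (distribʳ x _ _))

  Σ<-suc : ∀ n (f : ℕ → Carrier) → Σ< (suc n) f ≈ f 0 + Σ< n (λ i → f (suc i))
  Σ<-suc zero    f = +-comm 0# (f 0)
  Σ<-suc (suc n) f = trans (+-congʳ (Σ<-suc n f)) (+-assoc _ _ _)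

  Σ<-reverse : ∀ n (f : ℕ → Carrier) → Σ< n f ≈ Σ< n (λ i → f (n ∸ suc i))
  Σ<-reverse zero    f = refl
  Σ<-reverse (suc n) f = begin
    Σ< n f + f n                        ≈⟨ +-comm _ _ ⟩
    f n + Σ< n f                        ≈⟨ +-congˡ (Σ<-reverse n f) ⟩
    f n + Σ< n (λ i → f (n ∸ suc i))    ≈⟨ Σ<-suc n (λ i → f (n ∸ i)) ⟨
    Σ< (suc n) (λ i → f (n ∸ i))        ∎

  Σ<-extend : ∀ {N M} (f : ℕ → Carrier) → (∀ k → N < k → f k ≈ 0#) → N ≤ M →
              Σ< (suc N) f ≈ Σ< (suc M) f
  Σ<-extend {N} f tail≈0 N≤M = go (ℕ.≤⇒≤′ N≤M)
    where
    go : ∀ {M} → N ℕ.≤′ M → Σ< (suc N) f ≈ Σ< (suc M) f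
    go ℕ.≤′-refl = refl
    go {suc M} (ℕ.≤′-step N≤′M) = begin
      Σ< (suc N) f              ≈⟨ go N≤′M ⟩
      Σ< (suc M) f              ≈⟨ +-identityʳ _ ⟨
      Σ< (suc M) f + 0#         ≈⟨ +-congˡ (tail≈0 (suc M) (s≤s (ℕ.≤′⇒≤ N≤′M))) ⟨
      Σ< (suc M) f + f (suc M)  ∎

  HasSum⇒≈Σ< : ∀ {f s} ((N , _ , _) : HasSum f s) → ∀ {M} → N ≤ M → s ≈ Σ< (suc M) f
  HasSum⇒≈Σ< {f} (N , tail≈0 , s≈Σ) N≤M = trans s≈Σ (Σ<-extend f tail≈0 N≤M)

  *-·-comm : ∀ n x y → x * (n · y) ≈ n · (x * y)
  *-·-comm zero    x y = zeroʳ x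
  *-·-comm (suc n) x y = trans (distribˡ x y (n · y)) (+-congˡ (*-·-comm n x y))

  ⊛-suc : ∀ (f g : ℕ → Carrier) m → (f ⊛ g) (suc m) ≈
          (f 0 * g (suc m) + Σ< m (λ i → f (m ∸ i) * g (suc i))) + f (suc m) * g 0
  ⊛-suc f g m =
    +-cong (trans (Σ<-suc m F) (+-congˡ reindex)) (*-congˡ (reflexive (≡.cong g (ℕ.n∸n≡0 m))))
    where
    F : ℕ → Carrier
    F j = f j * g (suc m ∸ j)
    reindex : Σ< m (λ i → f (suc i) * g (m ∸ i)) ≈ Σ< m (λ i → f (m ∸ i) * g (suc i))
    reindex = trans (Σ<-reverse m _) (Σ<-cong m (λ i i<m →
      *-cong (reflexive (≡.cong f (≡.sym (ℕ.+-∸-assoc 1 i<m))))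
             (reflexive (≡.cong g (ℕ.m∸[m∸n]≡n i<m)))))

  ⊛-one-suc : ∀ (f : ℕ → Carrier) m → (f ⊛ one) (suc m) ≈ f (suc m)
  ⊛-one-suc f m = begin
    (f ⊛ one) (suc m)                                              ≈⟨ ⊛-suc f one m ⟩
    (f 0 * 0# + Σ< m (λ i → f (m ∸ i) * 0#)) + f (suc m) * 1#
      ≈⟨ +-cong (+-cong (zeroʳ _) (Σ<-zero m (λ _ → zeroʳ _))) (*-identityʳ _) ⟩
    (0# + 0#) + f (suc m)                                          ≈⟨ +-congʳ (+-identityʳ 0#) ⟩
    0# + f (suc m)                                                 ≈⟨ +-identityˡ _ ⟩
    f (suc m)                                                      ∎

  module _ (a : ℕ → Carrier) where

    pow-constant : ∀ k → pow a k 0 ≈ a 0 ^ k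
    pow-constant zero    = refl
    pow-constant (suc k) = trans (+-identityˡ _) (*-congˡ (pow-constant k))

    tilde-one : ∀ k → tilde a k 1 ≈ 0#
    tilde-one zero          = refl
    tilde-one (suc zero)    = refl
    tilde-one (suc (suc k)) = trans (+-identityˡ _) (trans (*-congˡ (tilde-one (suc k))) (zeroʳ _))

    pow-suc-split : ∀ k m →
      pow a (suc k) (suc m) ≈ (suc k · (a 0 ^ k)) * a (suc m) + tilde a (suc k) (suc m)
    pow-suc-split zero m = begin
      pow a 1 (suc m)         ≈⟨ ⊛-one-suc a m ⟩
      a (suc m)               ≈⟨ *-identityˡ _ ⟨
      1# * a (suc m)          ≈⟨ *-congʳ (+-identityʳ 1#) ⟨
      (1# + 0#) * a (suc m)   ≈⟨ +-identityʳ _ ⟨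
      (1# + 0#) * a (suc m) + 0# ∎
    pow-suc-split (suc k) m = begin
      pow a (suc (suc k)) (suc m)                                 ≈⟨ ⊛-suc a P m ⟩
      (a 0 * P (suc m) + s) + a (suc m) * P 0
        ≈⟨ +-cong (+-congʳ (*-congˡ (pow-suc-split k m))) (*-congˡ (pow-constant (suc k))) ⟩
      (a 0 * (C * a (suc m) + t) + s) + a (suc m) * y
        ≈⟨ solve 6 (λ a₀ C aₙ t s y →
             (a₀ :* (C :* aₙ :+ t) :+ s) :+ aₙ :* y := (y :+ a₀ :* C) :* aₙ :+ (s :+ a₀ :* t))
             refl (a 0) C (a (suc m)) t s y ⟩
      (y + a 0 * C) * a (suc m) + (s + a 0 * t)
        ≈⟨ +-congʳ (*-congʳ (+-congˡ (*-·-comm (suc k) (a 0) (a 0 ^ k)))) ⟩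
      (suc (suc k) · (a 0 ^ suc k)) * a (suc m) + tilde a (suc (suc k)) (suc m) ∎
      where
      P : ℕ → Carrier
      P = pow a (suc k)
      C t s y : Carrier
      C = suc k · (a 0 ^ k)
      t = tilde a (suc k) (suc m)
      s = Σ< m (λ i → a (m ∸ i) * P (suc i))
      y = a 0 ^ suc k

  module _ (a b : ℕ → Carrier) where

    reversionTerm : ℕ → ℕ → Carrier
    reversionTerm n k = b k * pow a k n

    linearCoefficientTerm : ℕ → Carrier
    linearCoefficientTerm k = suc k · (b (suc k) * (a 0 ^ k))

    tildeTerm : ℕ → ℕ → Carrier
    tildeTerm n k = b (suc k) * tilde a (suc k) n

    reversionTerm-suc : ∀ m k →
      reversionTerm (suc m) (suc k) ≈ linearCoefficientTerm k * a (suc m) + tildeTerm (suc m) k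
    reversionTerm-suc m k = begin
      b (suc k) * pow a (suc k) (suc m)                         ≈⟨ *-congˡ (pow-suc-split a k m) ⟩
      b (suc k) * (C * a (suc m) + tilde a (suc k) (suc m))     ≈⟨ distribˡ _ _ _ ⟩
      b (suc k) * (C * a (suc m)) + tildeTerm (suc m) k          ≈⟨ +-congʳ (*-assoc _ _ _) ⟨
      (b (suc k) * C) * a (suc m) + tildeTerm (suc m) k          ≈⟨ +-congʳ (*-congʳ (*-·-comm (suc k) _ _)) ⟩
      linearCoefficientTerm k * a (suc m) + tildeTerm (suc m) k  ∎
      where
      C : Carrier
      C = suc k · (a 0 ^ k)

    Σ<-reversionTerm-suc : ∀ m L → Σ< (suc (suc L)) (reversionTerm (suc m)) ≈
      Σ< (suc L) linearCoefficientTerm * a (suc m) + Σ< (suc L) (tildeTerm (suc m))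
    Σ<-reversionTerm-suc m L = begin
      Σ< (suc (suc L)) (reversionTerm (suc m))                       ≈⟨ Σ<-suc (suc L) _ ⟩
      b 0 * 0# + Σ< (suc L) (λ k → reversionTerm (suc m) (suc k))
        ≈⟨ +-cong (zeroʳ _) (Σ<-cong (suc L) (λ k _ → reversionTerm-suc m k)) ⟩
      0# + Σ< (suc L) (λ k → linearCoefficientTerm k * a (suc m) + tildeTerm (suc m) k)
        ≈⟨ +-identityˡ _ ⟩
      Σ< (suc L) (λ k → linearCoefficientTerm k * a (suc m) + tildeTerm (suc m) k)
        ≈⟨ Σ<-+ (suc L) _ _ ⟩
      Σ< (suc L) (λ k → linearCoefficientTerm k * a (suc m)) + Σ< (suc L) (tildeTerm (suc m))
        ≈⟨ +-congʳ (Σ<-*ʳ (suc L) linearCoefficientTerm _) ⟩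
      Σ< (suc L) linearCoefficientTerm * a (suc m) + Σ< (suc L) (tildeTerm (suc m)) ∎

    HasSum-reversionTerm-suc : ∀ m {d S T} →
      HasSum (reversionTerm (suc m)) d → HasSum linearCoefficientTerm S →
      HasSum (tildeTerm (suc m)) T → d ≈ S * a (suc m) + T
    HasSum-reversionTerm-suc m {d} {S} {T} hd@(N , _) hS@(NS , _) hT@(NT , _) = begin
      d                                                                      ≈⟨ HasSum⇒≈Σ< hd N≤L+1 ⟩
      Σ< (suc (suc L)) (reversionTerm (suc m))                               ≈⟨ Σ<-reversionTerm-suc m L ⟩
      Σ< (suc L) linearCoefficientTerm * a (suc m) + Σ< (suc L) (tildeTerm (suc m))
        ≈⟨ +-cong (*-congʳ (HasSum⇒≈Σ< hS NS≤L)) (HasSum⇒≈Σ< hT NT≤L) ⟨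
      S * a (suc m) + T                                                      ∎
      where
      L : ℕ
      L = N ⊔ NS ⊔ NT
      N≤L+1 : N ≤ suc L
      N≤L+1 = ℕ.m≤n⇒m≤1+n (ℕ.≤-trans (ℕ.m≤m⊔n N NS) (ℕ.m≤m⊔n _ NT))
      NS≤L : NS ≤ L
      NS≤L = ℕ.≤-trans (ℕ.m≤n⊔m N NS) (ℕ.m≤m⊔n _ NT)
      NT≤L : NT ≤ L
      NT≤L = ℕ.m≤n⊔m _ NT

    HasSum-tildeTerm-one : HasSum (tildeTerm 1) 0#
    HasSum-tildeTerm-one = 0 , (λ k _ → tildeTerm≈0 k) , sym (trans (+-identityˡ _) (tildeTerm≈0 0))
      where
      tildeTerm≈0 : ∀ k → tildeTerm 1 k ≈ 0#
      tildeTerm≈0 k = trans (*-congˡ (tilde-one a (suc k))) (zeroʳ _)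

  linear-unique-root : ∀ {s u x t} → 1# ≈ s * u → s * x + t ≈ 0# → x ≈ - (u * t)
  linear-unique-root {s} {u} {x} {t} 1≈su sx+t≈0 = begin
    x               ≈⟨ *-identityʳ x ⟨
    x * 1#          ≈⟨ *-congˡ 1≈su ⟩
    x * (s * u)     ≈⟨ solve 3 (λ x s u → x :* (s :* u) := u :* (s :* x)) refl x s u ⟩
    u * (s * x)     ≈⟨ *-congˡ (inverseˡ-unique (s * x) t sx+t≈0) ⟩
    u * - t         ≈⟨ -‿distribʳ-* u t ⟨
    - (u * t)       ∎

theorem1 : ∀ {c ℓ} (R : CommutativeRing c ℓ) → let open CommutativeRing R in let open Series R in
    (a b : ℕ → Carrier) →
    (∀ n → HasSum (λ k → b k * pow a k n) (δ n 1)) →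
    (∃ λ S → HasSum (λ k → suc k · (b (suc k) * (a 0 ^ k))) S) →
    ∀ n → 1 < n → ∀ T → HasSum (λ k → b (suc k) * tilde a (suc k) n) T →
    a n ≈ - (a 1 * T)
theorem1 R a b reversion (S , hS) (suc (suc m)) (s≤s (s≤s _)) T hT =
  linear-unique-root R (trans 1≈Sa₁+0 (+-identityʳ _)) (sym 0≈Saₙ+T)
  where
  open CommutativeRing R
  1≈Sa₁+0 : 1# ≈ S * a 1 + 0#
  1≈Sa₁+0 = HasSum-reversionTerm-suc R a b 0 (reversion 1) hS (HasSum-tildeTerm-one R a b)
  0≈Saₙ+T : 0# ≈ S * a (suc (suc m)) + T
  0≈Saₙ+T = HasSum-reversionTerm-suc R a b (suc m) (reversion (suc (suc m))) hS hT
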